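{- Let $d>0$, let $A$ be a full rank $r\times n$ integer matrix ($r\le n$) whose greatest divisor $\delta(A)$ divides $d$, and put $k=d/\delta(A)$. Let $U$ be an $n\times n$ unimodular integer matrix such that $AU$ is in RHNF form, i.e. $AU=[N\ O]$ with $N$ an $r\times r$ matrix in RHNF and $O$ a zero matrix, and let $U'$ be an $r\times r$ unimodular integer matrix such that $U'AU=[N'\ O]$ with $N'$ in LHNF. Let $B$ be any $(n-r)\times n$ integer matrix such that the $n\times n$ matrix $\begin{bmatrix} U'AU\\ B\end{bmatrix}$ is in LHNF and the product of its diagonal entries in positions $r+1,\dots,n$ equals $k$. Then $X=BU^{ -1}$ is an integer $(n-r)\times n$ matrix satisfying $\det\begin{bmatrix} A\\ X\end{bmatrix}=\pm d$.
   Context: An integer square matrix $U$ is unimodular if $\det U=\pm 1$. For a full rank integer $r\times n$ matrix $M$ with $r\le n$, the greatest divisor $\delta(M)$ is the greatest common divisor of all the $r\times r$ minors of $M$. A square nonsingular integer matrix $N=(a_{ij})$ is in LHNF if it is lower triangular, has nonnegative entries, and $a_{ii}>0$, $0\le a_{ji}<a_{ii}$ for all $j>i$ (column condition); it is in RHNF if it is lower triangular, has nonnegative entries, and $a_{ii}>0$, $0\le a_{ij}<a_{ii}$ for all $j<i$ (row condition). For $\begin{bmatrix} A\\ X\end{bmatrix}$ denotes the $n\times n$ matrix obtained by stacking the rows of $A$ above the rows of $X$. -}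

module Defs where

open import Data.Nat as ℕ using (ℕ; zero; suc)
open import Data.Fin as Fin using (Fin; zero; suc; punchIn; toℕ; _↑ˡ_; _↑ʳ_; splitAt)
open import Data.Integer as ℤ using (ℤ; +_; 0ℤ; 1ℤ; -1ℤ; _+_; _*_; -_; _≤_; _<_)
open import Data.Integer.Divisibility using (_∣_)
open import Data.Sum using (_⊎_; inj₁; inj₂)
open import Data.Product using (∃; _×_)
open import Relation.Binary.PropositionalEquality using (_≡_)
open import Relation.Nullary using (¬_)

Mat : ℕ → ℕ → Set
Mat m n = Fin m → Fin n → ℤ

sumF : ∀ {n} → (Fin n → ℤ) → ℤ
sumF {zero}  f = 0ℤ
sumF {suc n} f = f zero + sumF (λ i → f (suc i))

prodF : ∀ {n} → (Fin n → ℤ) → ℤ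
prodF {zero}  f = 1ℤ
prodF {suc n} f = f zero * prodF (λ i → f (suc i))

_·_ : ∀ {m n p} → Mat m n → Mat n p → Mat m p
(A · B) i j = sumF (λ k → A i k * B k j)

identity : ∀ {n} → Mat n n
identity i j with i Fin.≟ j
... | Relation.Nullary.yes _ = 1ℤ
... | Relation.Nullary.no  _ = 0ℤ

sgn : ℕ → ℤ
sgn zero    = 1ℤ
sgn (suc k) = - sgn k

det : ∀ {n} → Mat n n → ℤ
det {zero}  M = 1ℤ
det {suc n} M = sumF (λ j → sgn (toℕ j) * (M zero j * det (λ i k → M (suc i) (punchIn j k))))

Unimodular : ∀ {n} → Mat n n → Set
Unimodular U = det U ≡ 1ℤ ⊎ det U ≡ -1ℤ

IncreasingSel : ∀ {r n} → (Fin r → Fin n) → Set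
IncreasingSel {r} c = ∀ (i j : Fin r) → i Fin.< j → c i Fin.< c j

minor : ∀ {r n} → Mat r n → (Fin r → Fin n) → ℤ
minor A c = det (λ i j → A i (c j))

FullRank : ∀ {r n} → Mat r n → Set
FullRank {r} {n} A = ∃ λ (c : Fin r → Fin n) → IncreasingSel c × ¬ (minor A c ≡ 0ℤ)

-- g is the greatest divisor δ(A): the (nonnegative) gcd of all r×r minors
IsGreatestDivisor : ∀ {r n} → Mat r n → ℕ → Set
IsGreatestDivisor {r} {n} A g =
  (∀ (c : Fin r → Fin n) → IncreasingSel c → (+ g) ∣ minor A c) ×
  (∀ (e : ℤ) → (∀ (c : Fin r → Fin n) → IncreasingSel c → e ∣ minor A c) → e ∣ (+ g))

LowerTriangular : ∀ {n} → Mat n n → Set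
LowerTriangular N = ∀ i j → i Fin.< j → N i j ≡ 0ℤ

NonNeg : ∀ {n} → Mat n n → Set
NonNeg N = ∀ i j → 0ℤ ≤ N i j

PosDiag : ∀ {n} → Mat n n → Set
PosDiag N = ∀ i → 0ℤ < N i i

IsLHNF : ∀ {n} → Mat n n → Set
IsLHNF N = LowerTriangular N × NonNeg N × PosDiag N ×
           (∀ i j → i Fin.< j → N j i < N i i)

IsRHNF : ∀ {n} → Mat n n → Set
IsRHNF N = LowerTriangular N × NonNeg N × PosDiag N ×
           (∀ i j → j Fin.< i → N i j < N i i)

leftBlock : ∀ {p} r m → Mat p (r ℕ.+ m) → Mat p r
leftBlock r m M i j = M i (j ↑ˡ m)

rightBlock : ∀ {p} r m → Mat p (r ℕ.+ m) → Mat p m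
rightBlock r m M i j = M i (r ↑ʳ j)

stack : ∀ {r m n} → Mat r n → Mat m n → Mat (r ℕ.+ m) n
stack {r} A X i j with splitAt r i
... | inj₁ i' = A i' j
... | inj₂ i' = X i' j

-- Write N for the leading r×r block of A·U = [N 0] and V for the inverse of U (built from the
-- adjugate). Every column of A is N times a column of the first r rows of V, so det N divides every
-- maximal minor of A, hence δ(A). Conversely, with X the last rows of V, [A; X]·U = [N 0; 0 I], and
-- expanding det [A; X] along the rows of X shows that δ(A) divides it, hence divides det N. So
-- det N = ±δ(A). Finally [A; B·V] = [A·U; B]·V, where [A·U; B] is lower triangular with diagonal
-- product det N · k and det V = ±1, so det [A; B·V] = ±δ(A)·k = ±d. Multiplicativity of the
-- determinant (defined by expansion along the first row) comes from characterising it as the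
-- unique row-linear, skew-symmetric functional normalised at the identity.

module Submission where

open import Defs
open import Data.Nat as ℕ using (ℕ; zero; suc)
import Data.Nat.Properties as ℕP
import Data.Nat.Divisibility as ℕD
open import Data.Fin as Fin using (Fin; zero; suc; punchIn; punchOut; toℕ; _↑ˡ_; _↑ʳ_; splitAt)
import Data.Fin.Properties as FP
open import Data.Integer as ℤ using (ℤ; +_; -[1+_]; 0ℤ; 1ℤ; _+_; _*_; -_)
import Data.Integer.Properties as ℤP
import Data.Integer.Divisibility.Signed as ℤD
open import Data.Integer.Tactic.RingSolver using (solve-∀)
open import Data.Vec.Functional using (_∷_; tail; map; updateAt; insertAt; removeAt)
open import Data.Vec.Functional.Properties
  using (updateAt-updates; updateAt-minimal; insertAt-lookup; insertAt-punchIn)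
open import Data.Sum using (_⊎_; inj₁; inj₂)
open import Data.Product using (∃; _×_; _,_)
open import Function using (_∘_)
open import Relation.Nullary using (Dec; yes; no; contradiction)
open import Relation.Binary.PropositionalEquality

open ≡-Reasoning

-- Finite sums and products

sumF-cong : ∀ {n} {f g : Fin n → ℤ} → (∀ i → f i ≡ g i) → sumF f ≡ sumF g
sumF-cong {zero}  f≗g = refl
sumF-cong {suc n} f≗g = cong₂ _+_ (f≗g zero) (sumF-cong (f≗g ∘ suc))

sumF-zero : ∀ {n} (f : Fin n → ℤ) → (∀ i → f i ≡ 0ℤ) → sumF f ≡ 0ℤ
sumF-zero {zero}  f f≗0 = refl
sumF-zero {suc n} f f≗0 = cong₂ _+_ (f≗0 zero) (sumF-zero (f ∘ suc) (f≗0 ∘ suc))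

sumF-+ : ∀ {n} (f g : Fin n → ℤ) → sumF (λ i → f i + g i) ≡ sumF f + sumF g
sumF-+ {zero}  f g = refl
sumF-+ {suc n} f g = begin
  (f zero + g zero) + sumF (λ i → f (suc i) + g (suc i))
    ≡⟨ cong (_+_ (f zero + g zero)) (sumF-+ (f ∘ suc) (g ∘ suc)) ⟩
  (f zero + g zero) + (sumF (f ∘ suc) + sumF (g ∘ suc))
    ≡⟨ ℤP.+-assoc (f zero) (g zero) _ ⟩
  f zero + (g zero + (sumF (f ∘ suc) + sumF (g ∘ suc)))
    ≡⟨ cong (_+_ (f zero)) (middle-swap (g zero) (sumF (f ∘ suc)) (sumF (g ∘ suc))) ⟩
  f zero + (sumF (f ∘ suc) + (g zero + sumF (g ∘ suc)))
    ≡⟨ ℤP.+-assoc (f zero) (sumF (f ∘ suc)) _ ⟨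
  sumF f + sumF g ∎
  where
  middle-swap : ∀ (x y z : ℤ) → x + (y + z) ≡ y + (x + z)
  middle-swap = solve-∀

sumF-*ˡ : ∀ {n} (c : ℤ) (f : Fin n → ℤ) → sumF (λ i → c * f i) ≡ c * sumF f
sumF-*ˡ {zero}  c f = sym (ℤP.*-zeroʳ c)
sumF-*ˡ {suc n} c f =
  trans (cong (_+_ (c * f zero)) (sumF-*ˡ c (f ∘ suc))) (sym (ℤP.*-distribˡ-+ c _ _))

sumF-*ʳ : ∀ {n} (c : ℤ) (f : Fin n → ℤ) → sumF (λ i → f i * c) ≡ sumF f * c
sumF-*ʳ c f = trans (sumF-cong (λ i → ℤP.*-comm (f i) c)) (trans (sumF-*ˡ c f) (ℤP.*-comm c (sumF f)))

sumF-linear : ∀ {n} (a b : ℤ) (f g : Fin n → ℤ) →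
  sumF (λ i → a * f i + b * g i) ≡ a * sumF f + b * sumF g
sumF-linear a b f g =
  trans (sumF-+ (λ i → a * f i) (λ i → b * g i)) (cong₂ _+_ (sumF-*ˡ a f) (sumF-*ˡ b g))

sumF-neg : ∀ {n} (f : Fin n → ℤ) → sumF (λ i → - f i) ≡ - sumF f
sumF-neg {zero}  f = refl
sumF-neg {suc n} f =
  trans (cong (_+_ (- f zero)) (sumF-neg (f ∘ suc))) (sym (ℤP.neg-distrib-+ (f zero) _))

sumF-comm : ∀ {n m} (f : Fin n → Fin m → ℤ) →
  sumF (λ i → sumF (f i)) ≡ sumF (λ j → sumF (λ i → f i j))
sumF-comm {zero} {m} f = sym (sumF-zero {m} (λ _ → 0ℤ) (λ _ → refl))
sumF-comm {suc n} f =
  trans (cong (_+_ (sumF (f zero))) (sumF-comm (f ∘ suc))) (sym (sumF-+ (f zero) _))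

sumF-punchIn : ∀ {n} (k : Fin (suc n)) (f : Fin (suc n) → ℤ) →
  sumF f ≡ f k + sumF (f ∘ punchIn k)
sumF-punchIn zero f = refl
sumF-punchIn {suc n} (suc k) f =
  trans (cong (_+_ (f zero)) (sumF-punchIn k (f ∘ suc))) (exchange (f zero) (f (suc k)) _)
  where
  exchange : ∀ (x y z : ℤ) → x + (y + z) ≡ y + (x + z)
  exchange = solve-∀

sumF-drop : ∀ {n} (k : Fin (suc n)) (f : Fin (suc n) → ℤ) → f k ≡ 0ℤ → sumF f ≡ sumF (f ∘ punchIn k)
sumF-drop k f fk≡0 = trans (sumF-punchIn k f) (trans (cong (_+ sumF (f ∘ punchIn k)) fk≡0) (ℤP.+-identityˡ _))

sumF-↑ : ∀ r {m} (f : Fin (r ℕ.+ m) → ℤ) →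
  sumF f ≡ sumF (λ i → f (i ↑ˡ m)) + sumF (λ j → f (r ↑ʳ j))
sumF-↑ zero    f = sym (ℤP.+-identityˡ _)
sumF-↑ (suc r) f = trans (cong (_+_ (f zero)) (sumF-↑ r (f ∘ suc))) (sym (ℤP.+-assoc (f zero) _ _))

∣-sumF : ∀ {n} (g : ℤ) (f : Fin n → ℤ) → (∀ i → g ℤD.∣ f i) → g ℤD.∣ sumF f
∣-sumF {zero}  g f g∣f = ℤD.divides 0ℤ (sym (ℤP.*-zeroˡ g))
∣-sumF {suc n} g f g∣f = ℤD.∣m∣n⇒∣m+n (g∣f zero) (∣-sumF g (f ∘ suc) (g∣f ∘ suc))

prodF-cong : ∀ {n} {f g : Fin n → ℤ} → (∀ i → f i ≡ g i) → prodF f ≡ prodF g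
prodF-cong {zero}  f≗g = refl
prodF-cong {suc n} f≗g = cong₂ _*_ (f≗g zero) (prodF-cong (f≗g ∘ suc))

prodF-one : ∀ {n} (f : Fin n → ℤ) → (∀ i → f i ≡ 1ℤ) → prodF f ≡ 1ℤ
prodF-one {zero}  f f≗1 = refl
prodF-one {suc n} f f≗1 = cong₂ _*_ (f≗1 zero) (prodF-one (f ∘ suc) (f≗1 ∘ suc))

prodF-↑ : ∀ r {m} (f : Fin (r ℕ.+ m) → ℤ) →
  prodF f ≡ prodF (λ i → f (i ↑ˡ m)) * prodF (λ j → f (r ↑ʳ j))
prodF-↑ zero    f = sym (ℤP.*-identityˡ _)
prodF-↑ (suc r) f = trans (cong (f zero *_) (prodF-↑ r (f ∘ suc))) (sym (ℤP.*-assoc (f zero) _ _))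

infix 4 _≋_
_≋_ : ∀ {m n} → Mat m n → Mat m n → Set
M ≋ N = ∀ i j → M i j ≡ N i j

identity-diag : ∀ {n} (k : Fin n) → identity k k ≡ 1ℤ
identity-diag k with k Fin.≟ k
... | yes _   = refl
... | no k≢k = contradiction refl k≢k

identity-offdiag : ∀ {n} {k l : Fin n} → k ≢ l → identity k l ≡ 0ℤ
identity-offdiag {k = k} {l} k≢l with k Fin.≟ l
... | yes k≡l = contradiction k≡l k≢l
... | no _    = refl

identity-lower : ∀ {n} {k l : Fin n} → k Fin.< l → identity k l ≡ 0ℤ
identity-lower k<l = identity-offdiag (λ k≡l → ℕP.<-irrefl (cong toℕ k≡l) k<l)

identity-punchIn : ∀ {n} (k : Fin (suc n)) i j → identity (punchIn k i) (punchIn k j) ≡ identity i j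
identity-punchIn k i j with i Fin.≟ j
... | yes refl = identity-diag (punchIn k i)
... | no i≢j  = identity-offdiag (i≢j ∘ FP.punchIn-injective k i j)

sumF-identityʳ : ∀ {n} (f : Fin n → ℤ) j → sumF (λ k → f k * identity k j) ≡ f j
sumF-identityʳ {suc n} f j = begin
  sumF (λ k → f k * identity k j)
    ≡⟨ sumF-punchIn j (λ k → f k * identity k j) ⟩
  f j * identity j j + sumF (λ i → f (punchIn j i) * identity (punchIn j i) j)
    ≡⟨ cong₂ _+_ (trans (cong (f j *_) (identity-diag j)) (ℤP.*-identityʳ (f j)))
                 (sumF-zero _ (λ i → trans (cong (f (punchIn j i) *_) (identity-offdiag (FP.punchInᵢ≢i j i)))
                                            (ℤP.*-zeroʳ (f (punchIn j i))))) ⟩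
  f j + 0ℤ
    ≡⟨ ℤP.+-identityʳ (f j) ⟩
  f j ∎

sumF-identityˡ : ∀ {n} (f : Fin n → ℤ) i → sumF (λ k → identity i k * f k) ≡ f i
sumF-identityˡ f i =
  trans (sumF-cong (λ k → trans (ℤP.*-comm (identity i k) (f k)) (cong (f k *_) (identity-sym i k))))
        (sumF-identityʳ f i)
  where
  identity-sym : ∀ {n} (i k : Fin n) → identity i k ≡ identity k i
  identity-sym i k with i Fin.≟ k | k Fin.≟ i
  ... | yes _   | yes _   = refl
  ... | no _    | no _    = refl
  ... | yes i≡k | no k≢i = contradiction (sym i≡k) k≢i
  ... | no i≢k  | yes k≡i = contradiction (sym k≡i) i≢k

·-identityˡ : ∀ {n m} (Z : Mat n m) → identity · Z ≋ Z
·-identityˡ Z i j = sumF-identityˡ (λ k → Z k j) i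

·-identityʳ : ∀ {n m} (Z : Mat n m) → Z · identity ≋ Z
·-identityʳ Z i j = sumF-identityʳ (Z i) j

·-congˡ : ∀ {a b c} {X X′ : Mat a b} (Z : Mat b c) → X ≋ X′ → X · Z ≋ X′ · Z
·-congˡ Z X≋X′ i j = sumF-cong (λ k → cong (_* Z k j) (X≋X′ i k))

·-congʳ : ∀ {a b c} (X : Mat a b) {Z Z′ : Mat b c} → Z ≋ Z′ → X · Z ≋ X · Z′
·-congʳ X Z≋Z′ i j = sumF-cong (λ k → cong (X i k *_) (Z≋Z′ k j))

·-assoc : ∀ {a b c d} (X : Mat a b) (Y : Mat b c) (Z : Mat c d) → (X · Y) · Z ≋ X · (Y · Z)
·-assoc X Y Z i j = begin
  sumF (λ k → sumF (λ l → X i l * Y l k) * Z k j)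
    ≡⟨ sumF-cong (λ k → sym (sumF-*ʳ (Z k j) (λ l → X i l * Y l k))) ⟩
  sumF (λ k → sumF (λ l → X i l * Y l k * Z k j))
    ≡⟨ sumF-comm (λ k l → X i l * Y l k * Z k j) ⟩
  sumF (λ l → sumF (λ k → X i l * Y l k * Z k j))
    ≡⟨ sumF-cong (λ l → trans (sumF-cong (λ k → ℤP.*-assoc (X i l) (Y l k) (Z k j)))
                              (sumF-*ˡ (X i l) (λ k → Y l k * Z k j))) ⟩
  sumF (λ l → X i l * sumF (λ k → Y l k * Z k j)) ∎

-- The determinant is row-linear and skew-symmetric

sign : ∀ {n} → Fin n → ℤ
sign j = sgn (toℕ j)

sgn-square : ∀ k → sgn k * sgn k ≡ 1ℤ
sgn-square zero    = refl
sgn-square (suc k) = trans (neg*neg (sgn k)) (sgn-square k)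
  where
  neg*neg : ∀ x → (- x) * (- x) ≡ x * x
  neg*neg = solve-∀

minor₀ : ∀ {n} → Mat (suc n) (suc n) → Fin (suc n) → Mat n n
minor₀ M j i k = M (suc i) (punchIn j k)

expansionTerm : ∀ {n} → Mat (suc n) (suc n) → Fin (suc n) → ℤ
expansionTerm M j = sign j * (M zero j * det (minor₀ M j))

det-cong : ∀ {n} {M N : Mat n n} → M ≋ N → det M ≡ det N
det-cong {zero}  M≋N = refl
det-cong {suc n} M≋N = sumF-cong (λ j →
  cong₂ (λ x y → sign j * (x * y)) (M≋N zero j) (det-cong (λ i k → M≋N (suc i) (punchIn j k))))

module _ {q N : ℕ} where

  Extensional : (Mat q N → ℤ) → Set
  Extensional D = ∀ {M M′} → M ≋ M′ → D M ≡ D M′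

  AgreeOff : Fin q → Mat q N → Mat q N → Set
  AgreeOff i M M′ = ∀ k → k ≢ i → ∀ j → M k j ≡ M′ k j

  RowLinear : (Mat q N → ℤ) → Set
  RowLinear D = ∀ i (a b : ℤ) (M M₁ M₂ : Mat q N) →
    (∀ j → M i j ≡ a * M₁ i j + b * M₂ i j) → AgreeOff i M M₁ → AgreeOff i M M₂ →
    D M ≡ a * D M₁ + b * D M₂

  record RowSwap (a b : Fin q) (M M′ : Mat q N) : Set where
    field
      at-a      : M′ a ≡ M b
      at-b      : M′ b ≡ M a
      elsewhere : ∀ c → c ≢ a → c ≢ b → M′ c ≡ M c

  SkewSymmetric : (Mat q N → ℤ) → Set
  SkewSymmetric D = ∀ {a b} → a ≢ b → ∀ {M M′} → RowSwap a b M M′ → D M′ ≡ - D M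

  Alternating : (Mat q N → ℤ) → Set
  Alternating D = ∀ {a b} → a ≢ b → ∀ M → M a ≡ M b → D M ≡ 0ℤ

open RowSwap

RowSwap-sym : ∀ {q N a b} {M M′ : Mat q N} → RowSwap a b M M′ → RowSwap b a M M′
RowSwap-sym s = record
  { at-a = at-b s ; at-b = at-a s ; elsewhere = λ c c≢b c≢a → elsewhere s c c≢a c≢b }

x≡-x⇒x≡0 : ∀ x → x ≡ - x → x ≡ 0ℤ
x≡-x⇒x≡0 (+ zero)   _  = refl
x≡-x⇒x≡0 (+ suc n)  ()
x≡-x⇒x≡0 -[1+ n ]   ()

skew⇒alternating : ∀ {q N} {D : Mat q N → ℤ} → SkewSymmetric D → Alternating D
skew⇒alternating {D = D} skew a≢b M Ma≡Mb = x≡-x⇒x≡0 (D M) (skew a≢b (record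
  { at-a = Ma≡Mb ; at-b = sym Ma≡Mb ; elsewhere = λ _ _ _ → refl }))

-- pivot j k is the position of j once the index punchIn j k has been removed.
pivot : ∀ {n} → Fin (suc (suc n)) → Fin (suc n) → Fin (suc n)
pivot zero    k = zero
pivot (suc j) zero = j
pivot {suc n} (suc j) (suc k) = suc (pivot j k)
pivot {zero}  (suc j) (suc ())

punchIn-pivot : ∀ {n} (j : Fin (suc (suc n))) k → punchIn (punchIn j k) (pivot j k) ≡ j
punchIn-pivot zero    k    = refl
punchIn-pivot (suc j) zero = refl
punchIn-pivot {suc n} (suc j) (suc k) = cong suc (punchIn-pivot j k)

punchIn-pivot-punchIn : ∀ {n} (j : Fin (suc (suc n))) k (l : Fin n) →
  punchIn (punchIn j k) (punchIn (pivot j k) l) ≡ punchIn j (punchIn k l)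
punchIn-pivot-punchIn zero    k    l = refl
punchIn-pivot-punchIn (suc j) zero l = refl
punchIn-pivot-punchIn {suc n} (suc j) (suc k) zero    = refl
punchIn-pivot-punchIn {suc n} (suc j) (suc k) (suc l) = cong suc (punchIn-pivot-punchIn j k l)

sign-pivot : ∀ {n} (j : Fin (suc (suc n))) k → sign (punchIn j k) * sign (pivot j k) ≡ - (sign j * sign k)
sign-pivot zero    k    = shift (sign k)
  where
  shift : ∀ x → (- x) * 1ℤ ≡ - (1ℤ * x)
  shift = solve-∀
sign-pivot (suc j) zero = shift (sign j)
  where
  shift : ∀ x → 1ℤ * x ≡ - ((- x) * 1ℤ)
  shift = solve-∀
sign-pivot {suc n} (suc j) (suc k) = begin
  (- sign (punchIn j k)) * (- sign (pivot j k)) ≡⟨ neg*neg (sign (punchIn j k)) (sign (pivot j k)) ⟩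
  sign (punchIn j k) * sign (pivot j k)         ≡⟨ sign-pivot j k ⟩
  - (sign j * sign k)                           ≡⟨ cong -_ (neg*neg (sign j) (sign k)) ⟨
  - ((- sign j) * (- sign k))                   ∎
  where
  neg*neg : ∀ x y → (- x) * (- y) ≡ x * y
  neg*neg = solve-∀

doubleMinor : ∀ {n} → Mat n (suc (suc n)) → Fin (suc (suc n)) → Fin (suc n) → ℤ
doubleMinor R j k = det (λ i l → R i (punchIn j (punchIn k l)))

pairCofactor : ∀ {n} → Mat n (suc (suc n)) → Fin (suc (suc n)) → Fin (suc (suc n)) → ℤ
pairCofactor R a b with a Fin.≟ b
... | yes _   = 0ℤ
... | no a≢b = sign a * sign (punchOut a≢b) * doubleMinor R a (punchOut a≢b)

module _ {n : ℕ} (R : Mat n (suc (suc n))) where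

  pairCofactor-diag : ∀ a → pairCofactor R a a ≡ 0ℤ
  pairCofactor-diag a with a Fin.≟ a
  ... | yes _   = refl
  ... | no a≢a = contradiction refl a≢a

  pairCofactor-punchIn : ∀ j k → pairCofactor R j (punchIn j k) ≡ sign j * sign k * doubleMinor R j k
  pairCofactor-punchIn j k with j Fin.≟ punchIn j k
  ... | yes j≡jₖ = contradiction (sym j≡jₖ) (FP.punchInᵢ≢i j k)
  ... | no j≢jₖ  = cong (λ x → sign j * sign x * doubleMinor R j x)
                        (trans (FP.punchOut-cong j refl) (FP.punchOut-punchIn j))

  pairCofactor-punchIn-flip : ∀ j k →
    pairCofactor R (punchIn j k) j ≡ - (sign j * sign k * doubleMinor R j k)
  pairCofactor-punchIn-flip j k with punchIn j k Fin.≟ j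
  ... | yes jₖ≡j = contradiction jₖ≡j (FP.punchInᵢ≢i j k)
  ... | no jₖ≢j  = begin
    sign jₖ * sign (punchOut jₖ≢j) * doubleMinor R jₖ (punchOut jₖ≢j)
      ≡⟨ cong (λ x → sign jₖ * sign x * doubleMinor R jₖ x) punchOut≡pivot ⟩
    sign jₖ * sign (pivot j k) * doubleMinor R jₖ (pivot j k)
      ≡⟨ cong₂ _*_ (sign-pivot j k)
                   (det-cong (λ i l → cong (R i) (punchIn-pivot-punchIn j k l))) ⟩
    - (sign j * sign k) * doubleMinor R j k
      ≡⟨ ℤP.neg-distribˡ-* (sign j * sign k) (doubleMinor R j k) ⟨
    - (sign j * sign k * doubleMinor R j k) ∎
    where
    jₖ : Fin (suc (suc n))
    jₖ = punchIn j k
    punchOut≡pivot : punchOut jₖ≢j ≡ pivot j k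
    punchOut≡pivot = trans (FP.punchOut-cong jₖ (sym (punchIn-pivot j k))) (FP.punchOut-punchIn jₖ)

  pairCofactor-antisym : ∀ a b → pairCofactor R b a ≡ - pairCofactor R a b
  pairCofactor-antisym a b = by-cases (a Fin.≟ b)
    where
    by-cases : Dec (a ≡ b) → pairCofactor R b a ≡ - pairCofactor R a b
    by-cases (yes refl) = trans (pairCofactor-diag a) (cong -_ (sym (pairCofactor-diag a)))
    by-cases (no a≢b)   = subst (λ b → pairCofactor R b a ≡ - pairCofactor R a b) (FP.punchIn-punchOut a≢b)
      (trans (pairCofactor-punchIn-flip a k) (cong -_ (sym (pairCofactor-punchIn a k))))
      where
      k : Fin (suc n)
      k = punchOut a≢b

pairCofactor-cong : ∀ {n} {R R′ : Mat n (suc (suc n))} → R ≋ R′ →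
  ∀ a b → pairCofactor R a b ≡ pairCofactor R′ a b
pairCofactor-cong R≋R′ a b with a Fin.≟ b
... | yes _   = refl
... | no a≢b = cong (sign a * sign (punchOut a≢b) *_)
  (det-cong (λ i l → R≋R′ i (punchIn a (punchIn (punchOut a≢b) l))))

below₂ : ∀ {n} → Mat (suc (suc n)) (suc (suc n)) → Mat n (suc (suc n))
below₂ M i = M (suc (suc i))

det-two-rows : ∀ {n} (M : Mat (suc (suc n)) (suc (suc n))) →
  det M ≡ sumF (λ j → sumF (λ b → M zero j * M (suc zero) b * pairCofactor (below₂ M) j b))
det-two-rows {n} M = sumF-cong term≡
  where
  R : Mat n (suc (suc n))
  R = below₂ M
  regroup : ∀ (sj x sk y δ : ℤ) → sj * (x * (sk * (y * δ))) ≡ x * y * (sj * sk * δ)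
  regroup = solve-∀
  term≡ : ∀ j → expansionTerm M j ≡ sumF (λ b → M zero j * M (suc zero) b * pairCofactor R j b)
  term≡ j = begin
    sign j * (M zero j * sumF inner)
      ≡⟨ cong (sign j *_) (sumF-*ˡ (M zero j) inner) ⟨
    sign j * sumF (λ k → M zero j * inner k)
      ≡⟨ sumF-*ˡ (sign j) (λ k → M zero j * inner k) ⟨
    sumF (λ k → sign j * (M zero j * inner k))
      ≡⟨ sumF-cong (λ k → trans (regroup (sign j) (M zero j) (sign k) _ _)
           (cong (M zero j * M (suc zero) (punchIn j k) *_) (sym (pairCofactor-punchIn R j k)))) ⟩
    sumF (term ∘ punchIn j)
      ≡⟨ sumF-drop j term (trans (cong (M zero j * M (suc zero) j *_) (pairCofactor-diag R j))
                                 (ℤP.*-zeroʳ (M zero j * M (suc zero) j))) ⟨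
    sumF term ∎
    where
    inner : Fin (suc n) → ℤ
    inner k = sign k * (M (suc zero) (punchIn j k) * doubleMinor R j k)
    term : Fin (suc (suc n)) → ℤ
    term b = M zero j * M (suc zero) b * pairCofactor R j b

-- Swapping the first two rows exchanges the roles of a and b in det-two-rows, and pairCofactor is
-- antisymmetric.
det-swap-01 : ∀ {n} {M M′ : Mat (suc (suc n)) (suc (suc n))} →
  RowSwap zero (suc zero) M M′ → det M′ ≡ - det M
det-swap-01 {n} {M} {M′} s = begin
  det M′
    ≡⟨ det-two-rows M′ ⟩
  sumF (λ j → sumF (λ b → M′ zero j * M′ (suc zero) b * pairCofactor (below₂ M′) j b))
    ≡⟨ sumF-cong (λ j → sumF-cong (λ b → swapped j b)) ⟩
  sumF (λ j → sumF (λ b → - (M zero b * M (suc zero) j * pairCofactor (below₂ M) b j)))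
    ≡⟨ trans (sumF-cong (λ j → sumF-neg (λ b → term b j))) (sumF-neg (λ j → sumF (λ b → term b j))) ⟩
  - sumF (λ j → sumF (λ b → term b j))
    ≡⟨ cong -_ (sumF-comm term) ⟨
  - sumF (λ b → sumF (λ j → M zero b * M (suc zero) j * pairCofactor (below₂ M) b j))
    ≡⟨ cong -_ (det-two-rows M) ⟨
  - det M ∎
  where
  term : Fin (suc (suc n)) → Fin (suc (suc n)) → ℤ
  term b j = M zero b * M (suc zero) j * pairCofactor (below₂ M) b j
  flip : ∀ x y z → x * y * (- z) ≡ - (y * x * z)
  flip = solve-∀
  below-same : below₂ M′ ≋ below₂ M
  below-same i = cong-app (elsewhere s (suc (suc i)) (λ ()) (λ ()))
  swapped : ∀ j b → M′ zero j * M′ (suc zero) b * pairCofactor (below₂ M′) j b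
                  ≡ - (M zero b * M (suc zero) j * pairCofactor (below₂ M) b j)
  swapped j b = begin
    M′ zero j * M′ (suc zero) b * pairCofactor (below₂ M′) j b
      ≡⟨ cong₂ _*_ (cong₂ _*_ (cong-app (at-a s) j) (cong-app (at-b s) b))
                   (pairCofactor-cong below-same j b) ⟩
    M (suc zero) j * M zero b * pairCofactor (below₂ M) j b
      ≡⟨ cong (M (suc zero) j * M zero b *_) (pairCofactor-antisym (below₂ M) b j) ⟩
    M (suc zero) j * M zero b * - pairCofactor (below₂ M) b j
      ≡⟨ flip (M (suc zero) j) (M zero b) _ ⟩
    - (M zero b * M (suc zero) j * pairCofactor (below₂ M) b j) ∎

_[_]≔_ : ∀ {q N} → Mat q N → Fin q → (Fin N → ℤ) → Mat q N
M [ i ]≔ r = updateAt M i (λ _ → r)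

swapRows : ∀ {q N} → Fin q → Fin q → Mat q N → Mat q N
swapRows a b M = (M [ a ]≔ M b) [ b ]≔ M a

swapRows-isRowSwap : ∀ {q N} {a b : Fin q} → a ≢ b → (M : Mat q N) → RowSwap a b M (swapRows a b M)
swapRows-isRowSwap {a = a} {b} a≢b M = record
  { at-a      = trans (updateAt-minimal a b _ a≢b) (updateAt-updates a M)
  ; at-b      = updateAt-updates b (M [ a ]≔ M b)
  ; elsewhere = λ c c≢a c≢b → trans (updateAt-minimal c b _ c≢b) (updateAt-minimal c a M c≢a)
  }

RowSwap-unique : ∀ {q N} {a b : Fin q} {M M′ M″ : Mat q N} →
  RowSwap a b M M′ → RowSwap a b M M″ → M′ ≋ M″
RowSwap-unique {a = a} {b} {M′ = M′} {M″} s s′ c = cong-app (by-cases (c Fin.≟ a) (c Fin.≟ b))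
  where
  by-cases : Dec (c ≡ a) → Dec (c ≡ b) → M′ c ≡ M″ c
  by-cases (yes refl) _          = trans (at-a s) (sym (at-a s′))
  by-cases (no _)     (yes refl) = trans (at-b s) (sym (at-b s′))
  by-cases (no c≢a)   (no c≢b)   = trans (elsewhere s c c≢a c≢b) (sym (elsewhere s′ c c≢a c≢b))

det-skew-below : ∀ {n} → SkewSymmetric (det {n}) →
  ∀ {a b : Fin n} → a ≢ b → ∀ {M M′ : Mat (suc n) (suc n)} →
  RowSwap (suc a) (suc b) M M′ → det M′ ≡ - det M
det-skew-below skew {a} {b} a≢b {M} {M′} s = trans (sumF-cong term-neg) (sumF-neg (expansionTerm M))
  where
  minor-swap : ∀ j → RowSwap a b (minor₀ M j) (minor₀ M′ j)
  minor-swap j = record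
    { at-a      = cong (_∘ punchIn j) (at-a s)
    ; at-b      = cong (_∘ punchIn j) (at-b s)
    ; elsewhere = λ c c≢a c≢b →
        cong (_∘ punchIn j) (elsewhere s (suc c) (c≢a ∘ FP.suc-injective) (c≢b ∘ FP.suc-injective))
    }
  pull-neg : ∀ σ x δ → σ * (x * (- δ)) ≡ - (σ * (x * δ))
  pull-neg = solve-∀
  term-neg : ∀ j → expansionTerm M′ j ≡ - expansionTerm M j
  term-neg j = trans
    (cong₂ (λ x δ → sign j * (x * δ)) (cong-app (elsewhere s zero (λ ()) (λ ())) j)
                                      (skew a≢b (minor-swap j)))
    (pull-neg (sign j) (M zero j) (det (minor₀ M j)))

-- The swap of rows 0 and b is the conjugate of the swap of rows 0 and 1 by the swap of rows 1 and b.
det-skew-top : ∀ {n} → SkewSymmetric (det {suc n}) →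
  ∀ (b : Fin n) {M M′ : Mat (suc (suc n)) (suc (suc n))} →
  RowSwap zero (suc (suc b)) M M′ → det M′ ≡ - det M
det-skew-top {n} skew b {M} {M′} s = begin
  det M′               ≡⟨ det-cong (RowSwap-unique s conjugate) ⟩
  det X                ≡⟨ det-skew-below skew 0≢b′ s₃ ⟩
  - det X₂             ≡⟨ cong -_ (det-swap-01 s₂) ⟩
  - (- det X₁)         ≡⟨ ℤP.neg-involutive (det X₁) ⟩
  det X₁               ≡⟨ det-skew-below skew 0≢b′ s₁ ⟩
  - det M              ∎
  where
  b′ : Fin (suc (suc n))
  b′ = suc (suc b)
  0≢1 : zero ≢ suc zero
  0≢1 ()
  1≢b : suc zero ≢ b′
  1≢b ()
  0≢b′ : zero ≢ suc b
  0≢b′ ()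
  X₁ X₂ X : Mat (suc (suc n)) (suc (suc n))
  X₁ = swapRows (suc zero) b′ M
  X₂ = swapRows zero (suc zero) X₁
  X  = swapRows (suc zero) b′ X₂
  s₁ : RowSwap (suc zero) b′ M X₁
  s₁ = swapRows-isRowSwap 1≢b M
  s₂ : RowSwap zero (suc zero) X₁ X₂
  s₂ = swapRows-isRowSwap 0≢1 X₁
  s₃ : RowSwap (suc zero) b′ X₂ X
  s₃ = swapRows-isRowSwap 1≢b X₂
  conjugate : RowSwap zero b′ M X
  conjugate = record
    { at-a      = trans (elsewhere s₃ zero (λ ()) (λ ())) (trans (at-a s₂) (at-a s₁))
    ; at-b      = trans (at-b s₃) (trans (at-b s₂) (elsewhere s₁ zero (λ ()) (λ ())))
    ; elsewhere = λ { zero 0≢0 _ → contradiction refl 0≢0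
                    ; (suc zero) _ _ → trans (at-a s₃) (trans (elsewhere s₂ b′ (λ ()) (λ ())) (at-b s₁))
                    ; (suc (suc c)) _ c≢b → trans (elsewhere s₃ (suc (suc c)) (λ ()) c≢b)
                        (trans (elsewhere s₂ (suc (suc c)) (λ ()) (λ ()))
                               (elsewhere s₁ (suc (suc c)) (λ ()) c≢b)) }
    }

det-skew : ∀ {n} → SkewSymmetric (det {n})
det-skew {suc n}       {zero}        {zero}        0≢0 _ = contradiction refl 0≢0
det-skew {suc n}       {suc a}       {suc b}       a≢b s = det-skew-below det-skew (a≢b ∘ cong suc) s
det-skew {suc (suc n)} {zero}        {suc zero}    _   s = det-swap-01 s
det-skew {suc (suc n)} {suc zero}    {zero}        _   s = det-swap-01 (RowSwap-sym s)
det-skew {suc (suc n)} {zero}        {suc (suc b)} _   s = det-skew-top det-skew b s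
det-skew {suc (suc n)} {suc (suc a)} {zero}        _   s = det-skew-top det-skew a (RowSwap-sym s)

det-alternating : ∀ {n} → Alternating (det {n})
det-alternating = skew⇒alternating det-skew

det-linear : ∀ {n} → RowLinear (det {n})
det-linear {suc n} zero a b M M₁ M₂ row off₁ off₂ =
  trans (sumF-cong term-linear) (sumF-linear a b (expansionTerm M₁) (expansionTerm M₂))
  where
  distribute : ∀ a b σ x y δ → σ * ((a * x + b * y) * δ) ≡ a * (σ * (x * δ)) + b * (σ * (y * δ))
  distribute = solve-∀
  same-minor : ∀ {M′} → AgreeOff zero M M′ → ∀ j → det (minor₀ M j) ≡ det (minor₀ M′ j)
  same-minor off j = det-cong (λ i k → off (suc i) (λ ()) (punchIn j k))
  term-linear : ∀ j → expansionTerm M j ≡ a * expansionTerm M₁ j + b * expansionTerm M₂ j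
  term-linear j = begin
    sign j * (M zero j * det (minor₀ M j))
      ≡⟨ cong (λ x → sign j * (x * det (minor₀ M j))) (row j) ⟩
    sign j * ((a * M₁ zero j + b * M₂ zero j) * det (minor₀ M j))
      ≡⟨ distribute a b (sign j) (M₁ zero j) (M₂ zero j) (det (minor₀ M j)) ⟩
    a * (sign j * (M₁ zero j * det (minor₀ M j))) + b * (sign j * (M₂ zero j * det (minor₀ M j)))
      ≡⟨ cong₂ (λ δ₁ δ₂ → a * (sign j * (M₁ zero j * δ₁)) + b * (sign j * (M₂ zero j * δ₂)))
               (same-minor off₁ j) (same-minor off₂ j) ⟩
    a * expansionTerm M₁ j + b * expansionTerm M₂ j ∎
det-linear {suc n} (suc i) a b M M₁ M₂ row off₁ off₂ =
  trans (sumF-cong term-linear) (sumF-linear a b (expansionTerm M₁) (expansionTerm M₂))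
  where
  distribute : ∀ a b σ x δ₁ δ₂ →
    σ * (x * (a * δ₁ + b * δ₂)) ≡ a * (σ * (x * δ₁)) + b * (σ * (x * δ₂))
  distribute = solve-∀
  minor-linear : ∀ j → det (minor₀ M j) ≡ a * det (minor₀ M₁ j) + b * det (minor₀ M₂ j)
  minor-linear j = det-linear i a b (minor₀ M j) (minor₀ M₁ j) (minor₀ M₂ j) (row ∘ punchIn j)
    (λ k k≢i l → off₁ (suc k) (k≢i ∘ FP.suc-injective) (punchIn j l))
    (λ k k≢i l → off₂ (suc k) (k≢i ∘ FP.suc-injective) (punchIn j l))
  term-linear : ∀ j → expansionTerm M j ≡ a * expansionTerm M₁ j + b * expansionTerm M₂ j
  term-linear j = begin
    sign j * (M zero j * det (minor₀ M j))
      ≡⟨ cong (λ δ → sign j * (M zero j * δ)) (minor-linear j) ⟩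
    sign j * (M zero j * (a * det (minor₀ M₁ j) + b * det (minor₀ M₂ j)))
      ≡⟨ distribute a b (sign j) (M zero j) (det (minor₀ M₁ j)) (det (minor₀ M₂ j)) ⟩
    a * (sign j * (M zero j * det (minor₀ M₁ j))) + b * (sign j * (M zero j * det (minor₀ M₂ j)))
      ≡⟨ cong₂ (λ x₁ x₂ → a * (sign j * (x₁ * det (minor₀ M₁ j)))
                         + b * (sign j * (x₂ * det (minor₀ M₂ j))))
               (off₁ zero (λ ()) j) (off₂ zero (λ ()) j) ⟩
    a * expansionTerm M₁ j + b * expansionTerm M₂ j ∎

-- Characterisation of the determinant and multiplicativity

module _ {q N : ℕ} (D : Mat (suc q) N → ℤ) (v : Fin N → ℤ) where

  prepend-extensional : Extensional D → Extensional (λ Y → D (v ∷ Y))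
  prepend-extensional ext Y≋Y′ = ext (λ { zero j → refl ; (suc i) j → Y≋Y′ i j })

  prepend-linear : RowLinear D → RowLinear (λ Y → D (v ∷ Y))
  prepend-linear lin i a b Y Y₁ Y₂ row off₁ off₂ =
    lin (suc i) a b (v ∷ Y) (v ∷ Y₁) (v ∷ Y₂) row (lift off₁) (lift off₂)
    where
    lift : ∀ {Y′} → AgreeOff i Y Y′ → AgreeOff (suc i) (v ∷ Y) (v ∷ Y′)
    lift off zero    _     j = refl
    lift off (suc k) k≢1+i j = off k (k≢1+i ∘ cong suc) j

  prepend-skew : SkewSymmetric D → SkewSymmetric (λ Y → D (v ∷ Y))
  prepend-skew skew a≢b s = skew (a≢b ∘ FP.suc-injective) (record
    { at-a      = at-a s
    ; at-b      = at-b s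
    ; elsewhere = λ { zero _ _ → refl
                    ; (suc c) c≢a c≢b → elsewhere s c (c≢a ∘ cong suc) (c≢b ∘ cong suc) }
    })

module _ {q N N′ : ℕ} (f : (Fin N → ℤ) → (Fin N′ → ℤ)) (D : Mat q N′ → ℤ)
         (f-cong : ∀ {x y} → (∀ j → x j ≡ y j) → ∀ j → f x j ≡ f y j) where

  rowwise-extensional : Extensional D → Extensional (λ M → D (map f M))
  rowwise-extensional ext M≋M′ = ext (λ i → f-cong (M≋M′ i))

  rowwise-linear :
    (∀ a b x y z → (∀ j → z j ≡ a * x j + b * y j) → ∀ j → f z j ≡ a * f x j + b * f y j) →
    RowLinear D → RowLinear (λ M → D (map f M))
  rowwise-linear f-linear lin i a b M M₁ M₂ row off₁ off₂ =
    lin i a b (map f M) (map f M₁) (map f M₂) (f-linear a b (M₁ i) (M₂ i) (M i) row)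
      (λ k k≢i → f-cong (off₁ k k≢i)) (λ k k≢i → f-cong (off₂ k k≢i))

  rowwise-skew : SkewSymmetric D → SkewSymmetric (λ M → D (map f M))
  rowwise-skew skew a≢b s = skew a≢b (record
    { at-a = cong f (at-a s) ; at-b = cong f (at-b s)
    ; elsewhere = λ c c≢a c≢b → cong f (elsewhere s c c≢a c≢b) })

rotate : ∀ {q N} → Fin (suc q) → Mat (suc q) N → Mat (suc q) N
rotate k M = M k ∷ removeAt M k

rotate-sign : ∀ {q N} (D : Mat (suc q) N → ℤ) → Extensional D → SkewSymmetric D →
  ∀ k M → D (rotate k M) ≡ sign k * D M
rotate-sign D ext skew zero M =
  trans (ext (λ { zero j → refl ; (suc i) j → refl })) (sym (ℤP.*-identityˡ (D M)))
rotate-sign {suc q} D ext skew (suc k) M = begin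
  D (rotate (suc k) M)
    ≡⟨ skew (λ ()) swap-front ⟩
  - D (M zero ∷ rotate k (tail M))
    ≡⟨ cong -_ (rotate-sign (λ Y → D (M zero ∷ Y)) (prepend-extensional D (M zero) ext)
                            (prepend-skew D (M zero) skew) k (tail M)) ⟩
  - (sign k * D (M zero ∷ tail M))
    ≡⟨ cong (λ x → - (sign k * x)) (ext (λ { zero j → refl ; (suc i) j → refl })) ⟩
  - (sign k * D M)
    ≡⟨ ℤP.neg-distribˡ-* (sign k) (D M) ⟩
  sign (suc k) * D M ∎
  where
  swap-front : RowSwap zero (suc zero) (M zero ∷ rotate k (tail M)) (rotate (suc k) M)
  swap-front = record
    { at-a = refl ; at-b = refl
    ; elsewhere = λ { zero 0≢0 _ → contradiction refl 0≢0
                    ; (suc zero) _ 1≢1 → contradiction refl 1≢1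
                    ; (suc (suc i)) _ _ → refl } }

addRowMultiple-invariant : ∀ {q N} (D : Mat q N → ℤ) → RowLinear D → Alternating D →
  ∀ M {i p} → p ≢ i → (c : ℤ) → D (M [ i ]≔ (λ l → M i l + c * M p l)) ≡ D M
addRowMultiple-invariant {q} {N} D lin alt M {i} {p} p≢i c = begin
  D M′                   ≡⟨ lin i 1ℤ c M′ M Mₚ row (λ k k≢i → cong-app (updated-elsewhere k k≢i))
                              (λ k k≢i → cong-app (trans (updated-elsewhere k k≢i)
                                                         (sym (updateAt-minimal k i M k≢i)))) ⟩
  1ℤ * D M + c * D Mₚ    ≡⟨ cong (λ x → 1ℤ * D M + c * x) (alt p≢i Mₚ duplicate) ⟩
  1ℤ * D M + c * 0ℤ      ≡⟨ drop-zero c (D M) ⟩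
  D M                    ∎
  where
  M′ Mₚ : Mat q N
  M′ = M [ i ]≔ (λ l → M i l + c * M p l)
  Mₚ = M [ i ]≔ M p
  updated-elsewhere : ∀ k → k ≢ i → M′ k ≡ M k
  updated-elsewhere k k≢i = updateAt-minimal k i M k≢i
  row : ∀ l → M′ i l ≡ 1ℤ * M i l + c * Mₚ i l
  row l = trans (cong-app (updateAt-updates i M) l)
    (cong₂ (λ x y → x + c * y) (sym (ℤP.*-identityˡ (M i l))) (sym (cong-app (updateAt-updates i M) l)))
  duplicate : Mₚ p ≡ Mₚ i
  duplicate = trans (updateAt-minimal p i M p≢i) (sym (updateAt-updates i M))
  drop-zero : ∀ c x → 1ℤ * x + c * 0ℤ ≡ x
  drop-zero = solve-∀

update-all-rows : ∀ {q N} (f : Mat q N → ℤ) → Extensional f → (g : (Fin N → ℤ) → (Fin N → ℤ)) →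
  (∀ M i → f (M [ i ]≔ g (M i)) ≡ f M) → ∀ M → f (map g M) ≡ f M
update-all-rows {zero}  f ext g step M = ext (λ ())
update-all-rows {suc q} {N} f ext g step M = begin
  f (map g M)                 ≡⟨ ext (λ { zero j → refl ; (suc i) j → refl }) ⟩
  f′ (map g (tail M))
    ≡⟨ update-all-rows f′ (prepend-extensional f (g (M zero)) ext) g step′ (tail M) ⟩
  f′ (tail M)                 ≡⟨ ext (λ { zero j → refl ; (suc i) j → refl }) ⟩
  f (M [ zero ]≔ g (M zero))  ≡⟨ step M zero ⟩
  f M                         ∎
  where
  f′ : Mat q N → ℤ
  f′ Y = f (g (M zero) ∷ Y)
  step′ : ∀ Y i → f′ (Y [ i ]≔ g (Y i)) ≡ f′ Y
  step′ Y i = trans (ext (λ { zero j → refl ; (suc k) j → refl })) (step (g (M zero) ∷ Y) (suc i))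

expand-row₀ : ∀ {q N p} (D : Mat (suc q) N → ℤ) → RowLinear D →
  (c : Fin p → ℤ) (Y : Fin p → Fin N → ℤ) (M : Mat (suc q) N) →
  (∀ j → M zero j ≡ sumF (λ k → c k * Y k j)) → D M ≡ sumF (λ k → c k * D (Y k ∷ tail M))
expand-row₀ {p = zero} D lin c Y M row = begin
  D M                   ≡⟨ lin zero 0ℤ 0ℤ M M M (λ j → trans (row j) (vanish (M zero j)))
                               (λ _ _ _ → refl) (λ _ _ _ → refl) ⟩
  0ℤ * D M + 0ℤ * D M   ≡⟨ vanish (D M) ⟨
  0ℤ                    ∎
  where
  vanish : ∀ x → 0ℤ ≡ 0ℤ * x + 0ℤ * x
  vanish = solve-∀
expand-row₀ {N = N} {p = suc p} D lin c Y M row = begin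
  D M
    ≡⟨ lin zero (c zero) 1ℤ M (Y zero ∷ tail M) (rest ∷ tail M)
           (λ j → trans (row j) (cong (_+_ (c zero * Y zero j)) (sym (ℤP.*-identityˡ (rest j)))))
           (λ { zero 0≢0 → contradiction refl 0≢0 ; (suc k) _ j → refl })
           (λ { zero 0≢0 → contradiction refl 0≢0 ; (suc k) _ j → refl }) ⟩
  c zero * D (Y zero ∷ tail M) + 1ℤ * D (rest ∷ tail M)
    ≡⟨ cong (_+_ (c zero * D (Y zero ∷ tail M)))
            (trans (ℤP.*-identityˡ _)
                   (expand-row₀ D lin (c ∘ suc) (Y ∘ suc) (rest ∷ tail M) (λ j → refl))) ⟩
  sumF (λ k → c k * D (Y k ∷ tail M)) ∎
  where
  rest : Fin N → ℤ
  rest j = sumF (λ k → c (suc k) * Y (suc k) j)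

insertAt-off : ∀ {n} (x : Fin n → ℤ) k v {l} (k≢l : k ≢ l) → insertAt x k v l ≡ x (punchOut k≢l)
insertAt-off x k v k≢l = trans (cong (insertAt x k v) (sym (FP.punchIn-punchOut k≢l))) (insertAt-punchIn x k v _)

module _ {n : ℕ} (k : Fin (suc n)) where

  insertAt-cong : ∀ {x y : Fin n → ℤ} → (∀ j → x j ≡ y j) →
    ∀ l → insertAt x k 0ℤ l ≡ insertAt y k 0ℤ l
  insertAt-cong {x} {y} x≗y l with k Fin.≟ l
  ... | yes refl = trans (insertAt-lookup x k 0ℤ) (sym (insertAt-lookup y k 0ℤ))
  ... | no k≢l  = trans (insertAt-off x k 0ℤ k≢l) (trans (x≗y _) (sym (insertAt-off y k 0ℤ k≢l)))

  insertAt-linear : ∀ a b (x y z : Fin n → ℤ) → (∀ j → z j ≡ a * x j + b * y j) →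
    ∀ l → insertAt z k 0ℤ l ≡ a * insertAt x k 0ℤ l + b * insertAt y k 0ℤ l
  insertAt-linear a b x y z z≗ l with k Fin.≟ l
  ... | yes refl = begin
    insertAt z k 0ℤ k                                  ≡⟨ insertAt-lookup z k 0ℤ ⟩
    0ℤ                                                 ≡⟨ vanish a b ⟩
    a * 0ℤ + b * 0ℤ                                    ≡⟨ cong₂ (λ u v → a * u + b * v) (insertAt-lookup x k 0ℤ)
                                                                                         (insertAt-lookup y k 0ℤ) ⟨
    a * insertAt x k 0ℤ k + b * insertAt y k 0ℤ k      ∎
    where
    vanish : ∀ a b → 0ℤ ≡ a * 0ℤ + b * 0ℤ
    vanish = solve-∀
  ... | no k≢l  = trans (insertAt-off z k 0ℤ k≢l) (trans (z≗ _)
    (cong₂ (λ u v → a * u + b * v) (sym (insertAt-off x k 0ℤ k≢l)) (sym (insertAt-off y k 0ℤ k≢l))))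

  insertAt-removeAt : ∀ (y : Fin (suc n) → ℤ) l →
    insertAt (removeAt y k) k 0ℤ l ≡ y l + (- y k) * identity k l
  insertAt-removeAt y l with k Fin.≟ l
  ... | yes refl = trans (insertAt-lookup (removeAt y k) k 0ℤ) (cancel (y k))
    where
    cancel : ∀ x → 0ℤ ≡ x + (- x) * 1ℤ
    cancel = solve-∀
  ... | no k≢l  = trans (insertAt-off (removeAt y k) k 0ℤ k≢l)
    (trans (cong y (FP.punchIn-punchOut k≢l)) (keep (y l) (y k)))
    where
    keep : ∀ x z → x ≡ x + (- z) * 0ℤ
    keep = solve-∀

border : ∀ {n} → Fin (suc n) → Mat n n → Mat (suc n) (suc n)
border k Y = identity k ∷ map (λ y → insertAt y k 0ℤ) Y

border-identity : ∀ {n} (k : Fin (suc n)) → border k identity ≋ rotate k identity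
border-identity k zero    l = refl
border-identity k (suc i) l with k Fin.≟ l
... | yes refl = trans (insertAt-lookup (identity i) k 0ℤ) (sym (identity-offdiag (FP.punchInᵢ≢i k i)))
... | no k≢l  = begin
  insertAt (identity i) k 0ℤ l                      ≡⟨ insertAt-off (identity i) k 0ℤ k≢l ⟩
  identity i (punchOut k≢l)                         ≡⟨ identity-punchIn k i (punchOut k≢l) ⟨
  identity (punchIn k i) (punchIn k (punchOut k≢l)) ≡⟨ cong (identity (punchIn k i)) (FP.punchIn-punchOut k≢l) ⟩
  identity (punchIn k i) l                          ∎

-- Expand row 0 along the unit rows e_k. In D (e_k ∷ Y) the row e_k clears column k of Y, leaving
-- border k applied to a minor of M, on which D is again row-linear and skew-symmetric.
det-unique : ∀ {n} (D : Mat n n → ℤ) → Extensional D → RowLinear D → SkewSymmetric D →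
  ∀ M → D M ≡ det M * D identity
det-unique {zero}  D ext lin skew M = trans (ext (λ ())) (sym (ℤP.*-identityˡ (D identity)))
det-unique {suc n} D ext lin skew M = begin
  D M
    ≡⟨ expand-row₀ D lin (M zero) identity M (λ j → sym (sumF-identityʳ (M zero) j)) ⟩
  sumF (λ k → M zero k * D (identity k ∷ tail M))
    ≡⟨ sumF-cong (λ k → cong (M zero k *_) (clear-column k)) ⟩
  sumF (λ k → M zero k * D (border k (minor₀ M k)))
    ≡⟨ sumF-cong (λ k → cong (M zero k *_) (bordered-minor k)) ⟩
  sumF (λ k → M zero k * (det (minor₀ M k) * (sign k * D identity)))
    ≡⟨ sumF-cong (λ k → regroup (M zero k) (det (minor₀ M k)) (sign k) (D identity)) ⟩
  sumF (λ k → expansionTerm M k * D identity)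
    ≡⟨ sumF-*ʳ (D identity) (expansionTerm M) ⟩
  det M * D identity ∎
  where
  regroup : ∀ x δ σ d → x * (δ * (σ * d)) ≡ σ * (x * δ) * d
  regroup = solve-∀

  Dₑ : Fin (suc n) → Mat n (suc n) → ℤ
  Dₑ k Y = D (identity k ∷ Y)

  clear-column : ∀ k → D (identity k ∷ tail M) ≡ D (border k (minor₀ M k))
  clear-column k = sym (begin
    D (border k (minor₀ M k))
      ≡⟨ prepend-extensional D (identity k) ext (λ i → insertAt-removeAt k (M (suc i))) ⟩
    Dₑ k (map clear (tail M))
      ≡⟨ update-all-rows (Dₑ k) (prepend-extensional D (identity k) ext) clear step (tail M) ⟩
    Dₑ k (tail M) ∎)
    where
    clear : (Fin (suc n) → ℤ) → (Fin (suc n) → ℤ)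
    clear y l = y l + (- y k) * identity k l
    step : ∀ Y i → Dₑ k (Y [ i ]≔ clear (Y i)) ≡ Dₑ k Y
    step Y i = trans (ext (λ { zero j → refl ; (suc _) j → refl }))
      (addRowMultiple-invariant D lin (skew⇒alternating skew) (identity k ∷ Y) {suc i} {zero} (λ ()) (- Y i k))

  bordered-minor : ∀ k → D (border k (minor₀ M k)) ≡ det (minor₀ M k) * (sign k * D identity)
  bordered-minor k = begin
    D (border k (minor₀ M k))          ≡⟨ det-unique (D ∘ border k) extₖ linₖ skewₖ (minor₀ M k) ⟩
    det (minor₀ M k) * D (border k identity)
      ≡⟨ cong (det (minor₀ M k) *_) (trans (ext (border-identity k)) (rotate-sign D ext skew k identity)) ⟩
    det (minor₀ M k) * (sign k * D identity) ∎
    where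
    insert : (Fin n → ℤ) → (Fin (suc n) → ℤ)
    insert y = insertAt y k 0ℤ
    extₖ : Extensional (D ∘ border k)
    extₖ = rowwise-extensional insert (Dₑ k) (insertAt-cong k) (prepend-extensional D (identity k) ext)
    linₖ : RowLinear (D ∘ border k)
    linₖ = rowwise-linear insert (Dₑ k) (insertAt-cong k) (insertAt-linear k) (prepend-linear D (identity k) lin)
    skewₖ : SkewSymmetric (D ∘ border k)
    skewₖ = rowwise-skew insert (Dₑ k) (insertAt-cong k) (prepend-skew D (identity k) skew)

det-· : ∀ {n} (X Z : Mat n n) → det (X · Z) ≡ det X * det Z
det-· {n} X Z = trans (det-unique D ext lin skew X)
                  (cong (det X *_) (det-cong (·-identityˡ Z)))
  where
  times-Z : (Fin n → ℤ) → (Fin n → ℤ)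
  times-Z y j = sumF (λ k → y k * Z k j)
  times-Z-cong : ∀ {x y} → (∀ k → x k ≡ y k) → ∀ j → times-Z x j ≡ times-Z y j
  times-Z-cong x≗y j = sumF-cong (λ k → cong (_* Z k j) (x≗y k))
  distribute : ∀ a b x y z → (a * x + b * y) * z ≡ a * (x * z) + b * (y * z)
  distribute = solve-∀
  times-Z-linear : ∀ a b x y z → (∀ k → z k ≡ a * x k + b * y k) →
    ∀ j → times-Z z j ≡ a * times-Z x j + b * times-Z y j
  times-Z-linear a b x y z z≗ j =
    trans (sumF-cong (λ k → trans (cong (_* Z k j) (z≗ k)) (distribute a b (x k) (y k) (Z k j))))
          (sumF-linear a b (λ k → x k * Z k j) (λ k → y k * Z k j))
  D : Mat n n → ℤ
  D Y = det (map times-Z Y)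
  ext : Extensional D
  ext = rowwise-extensional times-Z det times-Z-cong det-cong
  lin : RowLinear D
  lin = rowwise-linear times-Z det times-Z-cong times-Z-linear det-linear
  skew : SkewSymmetric D
  skew = rowwise-skew times-Z det times-Z-cong det-skew

det-lowerTriangular : ∀ {n} (M : Mat n n) → LowerTriangular M → det M ≡ prodF (λ i → M i i)
det-lowerTriangular {zero}  M lower = refl
det-lowerTriangular {suc n} M lower = begin
  expansionTerm M zero + sumF (expansionTerm M ∘ suc)
    ≡⟨ cong₂ _+_ (cong (λ δ → 1ℤ * (M zero zero * δ))
                       (det-lowerTriangular (minor₀ M zero) (λ i j i<j → lower (suc i) (suc j) (ℕ.s≤s i<j))))
                 (sumF-zero (expansionTerm M ∘ suc) above-diagonal) ⟩
  1ℤ * prodF (λ i → M i i) + 0ℤ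
    ≡⟨ trans (ℤP.+-identityʳ _) (ℤP.*-identityˡ _) ⟩
  prodF (λ i → M i i) ∎
  where
  above-diagonal : ∀ j → expansionTerm M (suc j) ≡ 0ℤ
  above-diagonal j = trans (cong (λ x → sign (suc j) * (x * det (minor₀ M (suc j))))
                                (lower zero (suc j) (ℕ.s≤s ℕ.z≤n)))
                           (ℤP.*-zeroʳ (sign (suc j)))

det-identity : ∀ {n} → det (identity {n}) ≡ 1ℤ
det-identity {n} = trans (det-lowerTriangular (identity {n}) (λ i j → identity-lower))
                         (prodF-one {n} (λ i → identity i i) identity-diag)

-- Cofactor expansion and inverses of unimodular matrices

cofactor : ∀ {n} → Mat (suc n) (suc n) → Fin (suc n) → Fin (suc n) → ℤ
cofactor M j k = sign j * sign k * det (λ i l → M (punchIn j i) (punchIn k l))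

det-expand-row : ∀ {n} (M : Mat (suc n) (suc n)) j → sumF (λ k → M j k * cofactor M j k) ≡ det M
det-expand-row M j = begin
  sumF (λ k → M j k * cofactor M j k)
    ≡⟨ sumF-cong (λ k → regroup (M j k) (sign j) (sign k) (det (λ i l → M (punchIn j i) (punchIn k l)))) ⟩
  sumF (λ k → sign j * expansionTerm (rotate j M) k)
    ≡⟨ sumF-*ˡ (sign j) (expansionTerm (rotate j M)) ⟩
  sign j * det (rotate j M)
    ≡⟨ cong (sign j *_) (rotate-sign det det-cong det-skew j M) ⟩
  sign j * (sign j * det M)
    ≡⟨ ℤP.*-assoc (sign j) (sign j) (det M) ⟨
  sign j * sign j * det M
    ≡⟨ cong (_* det M) (sgn-square (toℕ j)) ⟩
  1ℤ * det M
    ≡⟨ ℤP.*-identityˡ (det M) ⟩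
  det M ∎
  where
  regroup : ∀ x σ σ′ δ → x * (σ * σ′ * δ) ≡ σ * (σ′ * (x * δ))
  regroup = solve-∀

det-expand-other-row : ∀ {n} (M : Mat (suc n) (suc n)) {i j} → i ≢ j →
  sumF (λ k → M i k * cofactor M j k) ≡ 0ℤ
det-expand-other-row {n} M {i} {j} i≢j = begin
  sumF (λ k → M i k * cofactor M j k)
    ≡⟨ sumF-cong (λ k → cong₂ _*_ (sym (cong-app (updateAt-updates j {λ _ → M i} M) k))
                                  (cofactor-unchanged k)) ⟩
  sumF (λ k → M′ j k * cofactor M′ j k)
    ≡⟨ det-expand-row M′ j ⟩
  det M′
    ≡⟨ det-alternating i≢j M′ (trans (updateAt-minimal i j M i≢j) (sym (updateAt-updates j M))) ⟩
  0ℤ ∎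
  where
  M′ : Mat (suc n) (suc n)
  M′ = M [ j ]≔ M i
  cofactor-unchanged : ∀ k → cofactor M j k ≡ cofactor M′ j k
  cofactor-unchanged k = cong (sign j * sign k *_) (det-cong (λ a l →
    sym (cong-app (updateAt-minimal (punchIn j a) j M (FP.punchInᵢ≢i j a)) (punchIn k l))))

infix 4 _≡±_
_≡±_ : ℤ → ℤ → Set
x ≡± a = x ≡ a ⊎ x ≡ - a

≡±-resp : ∀ {x y a b} → x ≡ y → a ≡ b → x ≡± a → y ≡± b
≡±-resp refl refl x≡±a = x≡±a

≡±-* : ∀ {x y a b} → x ≡± a → y ≡± b → x * y ≡± a * b
≡±-* {a = a} {b} (inj₁ refl) (inj₁ refl) = inj₁ refl
≡±-* {a = a} {b} (inj₁ refl) (inj₂ refl) = inj₂ (sym (ℤP.neg-distribʳ-* a b))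
≡±-* {a = a} {b} (inj₂ refl) (inj₁ refl) = inj₂ (sym (ℤP.neg-distribˡ-* a b))
≡±-* {a = a} {b} (inj₂ refl) (inj₂ refl) = inj₁ (neg*neg a b)
  where
  neg*neg : ∀ a b → (- a) * (- b) ≡ a * b
  neg*neg = solve-∀

unit-square : ∀ {x} → x ≡± 1ℤ → x * x ≡ 1ℤ
unit-square (inj₁ refl) = refl
unit-square (inj₂ refl) = refl

unit-factor : ∀ {x} y → x ≡± 1ℤ → x * y ≡ 1ℤ → y ≡± 1ℤ
unit-factor y (inj₁ refl) xy≡1 = inj₁ (trans (sym (ℤP.*-identityˡ y)) xy≡1)
unit-factor y (inj₂ refl) xy≡1 =
  inj₂ (trans (sym (ℤP.neg-involutive y)) (cong -_ (trans (sym (ℤP.-1*i≡-i y)) xy≡1)))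

right-inverse : ∀ {n} (U : Mat n n) → Unimodular U → ∃ λ V → U · V ≋ identity
right-inverse {zero}  U _          = U , λ ()
right-inverse {suc n} U unimodular = V , U·V≋I
  where
  V : Mat (suc n) (suc n)
  V k j = det U * cofactor U j k
  exchange : ∀ x y z → x * (y * z) ≡ y * (x * z)
  exchange = solve-∀
  U·V≋I : U · V ≋ identity
  U·V≋I i j with trans (sumF-cong (λ k → exchange (U i k) (det U) (cofactor U j k)))
                       (sumF-*ˡ (det U) (λ k → U i k * cofactor U j k))
  ... | U·V≡ with i Fin.≟ j
  ...   | yes refl = trans U·V≡ (trans (cong (det U *_) (det-expand-row U i)) (unit-square unimodular))
  ...   | no i≢j  = trans U·V≡ (trans (cong (det U *_) (det-expand-other-row U i≢j)) (ℤP.*-zeroʳ (det U)))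

unimodular-inverse : ∀ {n} (U : Mat n n) → Unimodular U →
  ∃ λ V → U · V ≋ identity × V · U ≋ identity
unimodular-inverse {n} U unimodular with right-inverse U unimodular
... | V , U·V≋I with right-inverse V (unit-factor (det V) unimodular
                                        (trans (sym (det-· U V)) (trans (det-cong U·V≋I) (det-identity {n}))))
... | W , V·W≋I = V , U·V≋I , λ i j → trans (·-congʳ V U≋W i j) (V·W≋I i j)
  where
  U≋W : U ≋ W
  U≋W i j = begin
    U i j                ≡⟨ ·-identityʳ U i j ⟨
    (U · identity) i j   ≡⟨ ·-congʳ U V·W≋I i j ⟨
    (U · (V · W)) i j    ≡⟨ ·-assoc U V W i j ⟨
    ((U · V) · W) i j    ≡⟨ ·-congˡ W U·V≋I i j ⟩
    (identity · W) i j   ≡⟨ ·-identityˡ W i j ⟩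
    W i j                ∎

-- Divisibility of a determinant by the maximal minors of its top rows

toℕ-punchIn-below : ∀ {n} (i : Fin (suc n)) (j : Fin n) →
  toℕ j ℕ.< toℕ i → toℕ (punchIn i j) ≡ toℕ j
toℕ-punchIn-below (suc i) zero    _         = refl
toℕ-punchIn-below (suc i) (suc j) (ℕ.s≤s j<i) = cong suc (toℕ-punchIn-below i j j<i)

punchIn-increasing : ∀ {r n} (k : Fin (suc n)) (c : Fin r → Fin n) →
  IncreasingSel c → IncreasingSel (punchIn k ∘ c)
punchIn-increasing k c increasing a b a<b = ℕP.≤∧≢⇒<
  (FP.punchIn-mono-≤ k (c a) (c b) (ℕP.<⇒≤ (increasing a b a<b)))
  (λ eq → ℕP.<⇒≢ (increasing a b a<b) (cong toℕ (FP.punchIn-injective k (c a) (c b) (FP.toℕ-injective eq))))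

inject≤-increasing : ∀ {r n} (r≤n : r ℕ.≤ n) → IncreasingSel (λ (j : Fin r) → Fin.inject≤ j r≤n)
inject≤-increasing r≤n a b a<b =
  subst₂ ℕ._<_ (sym (FP.toℕ-inject≤ a r≤n)) (sym (FP.toℕ-inject≤ b r≤n)) a<b

-- Expand along row r, the first row below the top block: every cofactor is a determinant of the
-- same kind, one size smaller.
∣top-minors⇒∣det : ∀ {r n} (r≤n : r ℕ.≤ n) (M : Mat n n) (g : ℤ) →
  (∀ c → IncreasingSel c → g ℤD.∣ det (λ i j → M (Fin.inject≤ i r≤n) (c j))) → g ℤD.∣ det M
∣top-minors⇒∣det {n = zero}  ℕ.z≤n M g g∣minors = g∣minors (λ ()) (λ ())
∣top-minors⇒∣det {r} {suc n} r≤n M g g∣minors with ℕP.m≤n⇒m<n∨m≡n r≤n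
... | inj₂ refl =
  subst (g ℤD.∣_) (det-cong (λ i j → cong₂ M (FP.inject≤-refl i r≤n) (FP.inject≤-refl j r≤n)))
                        (g∣minors (λ j → Fin.inject≤ j r≤n) (inject≤-increasing r≤n))
... | inj₁ (ℕ.s≤s r≤n′) = subst (g ℤD.∣_) (det-expand-row M j₀)
  (∣-sumF g _ (λ k → ℤD.∣n⇒∣m*n (M j₀ k) (ℤD.∣n⇒∣m*n (sign j₀ * sign k) (∣minor k))))
  where
  j₀ : Fin (suc n)
  j₀ = Fin.fromℕ< (ℕ.s≤s r≤n′)
  top-row : ∀ i → punchIn j₀ (Fin.inject≤ i r≤n′) ≡ Fin.inject≤ i r≤n
  top-row i = FP.toℕ-injective (begin
    toℕ (punchIn j₀ (Fin.inject≤ i r≤n′))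
      ≡⟨ toℕ-punchIn-below j₀ _ (subst₂ ℕ._<_ (sym (FP.toℕ-inject≤ i r≤n′))
                                                (sym (FP.toℕ-fromℕ< (ℕ.s≤s r≤n′))) (FP.toℕ<n i)) ⟩
    toℕ (Fin.inject≤ i r≤n′)  ≡⟨ FP.toℕ-inject≤ i r≤n′ ⟩
    toℕ i                     ≡⟨ FP.toℕ-inject≤ i r≤n ⟨
    toℕ (Fin.inject≤ i r≤n)   ∎)
  ∣minor : ∀ k → g ℤD.∣ det (λ a l → M (punchIn j₀ a) (punchIn k l))
  ∣minor k = ∣top-minors⇒∣det r≤n′ (λ a l → M (punchIn j₀ a) (punchIn k l)) g (λ c increasing →
    subst (g ℤD.∣_) (det-cong (λ i l → cong (λ a → M a (punchIn k (c l))) (sym (top-row i))))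
          (g∣minors (punchIn k ∘ c) (punchIn-increasing k c increasing)))

-- Stacked matrices and the leading block of A·U

module _ {r m : ℕ} where

  stack-↑ˡ : ∀ {n} (X : Mat r n) (Y : Mat m n) a j → stack X Y (a ↑ˡ m) j ≡ X a j
  stack-↑ˡ X Y a j rewrite FP.splitAt-↑ˡ r a m = refl

  stack-↑ʳ : ∀ {n} (X : Mat r n) (Y : Mat m n) b j → stack X Y (r ↑ʳ b) j ≡ Y b j
  stack-↑ʳ X Y b j rewrite FP.splitAt-↑ʳ r m b = refl

  stack-· : ∀ {n p} (X : Mat r n) (Y : Mat m n) (Z : Mat n p) → stack X Y · Z ≋ stack (X · Z) (Y · Z)
  stack-· X Y Z i j with splitAt r i
  ... | inj₁ a = refl
  ... | inj₂ b = refl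

  stack-lowerTriangular : ∀ (T : Mat r (r ℕ.+ m)) (Y : Mat m (r ℕ.+ m)) →
    LowerTriangular (leftBlock r m T) → (∀ i j → rightBlock r m T i j ≡ 0ℤ) →
    (∀ b j → (r ↑ʳ b) Fin.< j → Y b j ≡ 0ℤ) → LowerTriangular (stack T Y)
  stack-lowerTriangular T Y lowerT rightT lowerY i j i<j with splitAt r i in splitᵢ
  ... | inj₂ b = lowerY b j (subst (Fin._< j) (sym (FP.splitAt⁻¹-↑ʳ splitᵢ)) i<j)
  ... | inj₁ a with splitAt r j in splitⱼ
  ...   | inj₂ b = trans (cong (T a) (sym (FP.splitAt⁻¹-↑ʳ splitⱼ))) (rightT a b)
  ...   | inj₁ a′ = trans (cong (T a) (sym (FP.splitAt⁻¹-↑ˡ splitⱼ))) (lowerT a a′ a<a′)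
    where
    a<a′ : a Fin.< a′
    a<a′ = subst₂ ℕ._<_ (trans (cong toℕ (sym (FP.splitAt⁻¹-↑ˡ splitᵢ))) (FP.toℕ-↑ˡ a m))
                        (trans (cong toℕ (sym (FP.splitAt⁻¹-↑ˡ splitⱼ))) (FP.toℕ-↑ˡ a′ m)) i<j

  det-stack-lowerTriangular : ∀ (T : Mat r (r ℕ.+ m)) (Y : Mat m (r ℕ.+ m)) → LowerTriangular (stack T Y) →
    det (stack T Y) ≡ prodF (λ a → T a (a ↑ˡ m)) * prodF (λ b → Y b (r ↑ʳ b))
  det-stack-lowerTriangular T Y lower =
    trans (det-lowerTriangular (stack T Y) lower)
          (trans (prodF-↑ r (λ i → stack T Y i i))
                 (cong₂ _*_ (prodF-cong (λ a → stack-↑ˡ T Y a (a ↑ˡ m)))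
                            (prodF-cong (λ b → stack-↑ʳ T Y b (r ↑ʳ b)))))

  stack-congˡ : ∀ {n} {X X′ : Mat r n} (Y : Mat m n) → X ≋ X′ → stack X Y ≋ stack X′ Y
  stack-congˡ Y X≋X′ i j with splitAt r i
  ... | inj₁ a = X≋X′ a j
  ... | inj₂ b = refl

  inject≤-↑ˡ : ∀ (i : Fin r) → Fin.inject≤ i (ℕP.m≤m+n r m) ≡ i ↑ˡ m
  inject≤-↑ˡ i = FP.toℕ-injective (trans (FP.toℕ-inject≤ i (ℕP.m≤m+n r m)) (sym (FP.toℕ-↑ˡ i m)))

∣x∣≡n⇒x≡±n : ∀ x {n} → ℤ.∣ x ∣ ≡ n → x ≡± + n
∣x∣≡n⇒x≡±n (+ _)    refl = inj₁ refl
∣x∣≡n⇒x≡±n -[1+ _ ] refl = inj₂ refl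

module LeadingBlock {r m : ℕ} (A : Mat r (r ℕ.+ m)) (U V : Mat (r ℕ.+ m) (r ℕ.+ m))
       (U·V≋I : U · V ≋ identity) (V·U≋I : V · U ≋ identity)
       (right-zero : ∀ i j → rightBlock r m (A · U) i j ≡ 0ℤ) where

  N : Mat r r
  N = leftBlock r m (A · U)

  A·U·V≋A : (A · U) · V ≋ A
  A·U·V≋A i j = trans (·-assoc A U V i j) (trans (·-congʳ A U·V≋I i j) (·-identityʳ A i j))

  det-∣-minors : ∀ c → IncreasingSel c → det N ℤD.∣ minor A c
  det-∣-minors c _ =
    subst (det N ℤD.∣_) (sym (trans (det-cong A≋N·W) (det-· N W))) (ℤD.∣m⇒∣m*n (det W) ℤD.∣-refl)
    where
    W : Mat r r
    W a j = V (a ↑ˡ m) (c j)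
    A≋N·W : (λ i j → A i (c j)) ≋ N · W
    A≋N·W i j = begin
      A i (c j)
        ≡⟨ A·U·V≋A i (c j) ⟨
      ((A · U) · V) i (c j)
        ≡⟨ sumF-↑ r (λ l → (A · U) i l * V l (c j)) ⟩
      (N · W) i j + sumF (λ b → (A · U) i (r ↑ʳ b) * V (r ↑ʳ b) (c j))
        ≡⟨ cong (_+_ ((N · W) i j)) (sumF-zero _ (λ b → trans (cong (_* V (r ↑ʳ b) (c j)) (right-zero i b))
                                                              (ℤP.*-zeroˡ (V (r ↑ʳ b) (c j))))) ⟩
      (N · W) i j + 0ℤ
        ≡⟨ ℤP.+-identityʳ _ ⟩
      (N · W) i j ∎

  ∣-det : ∀ g → (∀ c → IncreasingSel c → g ℤD.∣ minor A c) → LowerTriangular N → g ℤD.∣ det N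
  ∣-det g g∣minors lowerN = subst (g ℤD.∣_) det-S·U (ℤD.∣m⇒∣m*n (det U) g∣det-S)
    where
    X : Mat m (r ℕ.+ m)
    X b = V (r ↑ʳ b)
    S : Mat (r ℕ.+ m) (r ℕ.+ m)
    S = stack A X
    g∣det-S : g ℤD.∣ det S
    g∣det-S = ∣top-minors⇒∣det (ℕP.m≤m+n r m) S g (λ c increasing →
      subst (g ℤD.∣_) (det-cong (λ i j → sym (trans (cong (λ a → S a (c j)) (inject≤-↑ˡ i))
                                                    (stack-↑ˡ A X i (c j)))))
            (g∣minors c increasing))
    X·U≋I : ∀ b j → (X · U) b j ≡ identity (r ↑ʳ b) j
    X·U≋I b = V·U≋I (r ↑ʳ b)
    lower : LowerTriangular (stack (A · U) (X · U))
    lower = stack-lowerTriangular (A · U) (X · U) lowerN right-zero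
      (λ b j b<j → trans (X·U≋I b j) (identity-lower b<j))
    det-S·U : det S * det U ≡ det N
    det-S·U = begin
      det S * det U                                 ≡⟨ det-· S U ⟨
      det (S · U)                                   ≡⟨ det-cong (stack-· A X U) ⟩
      det (stack (A · U) (X · U))                   ≡⟨ det-stack-lowerTriangular (A · U) (X · U) lower ⟩
      prodF (λ a → N a a) * prodF (λ b → (X · U) b (r ↑ʳ b))
        ≡⟨ cong₂ _*_ (sym (det-lowerTriangular N lowerN))
                     (prodF-one _ (λ b → trans (X·U≋I b (r ↑ʳ b)) (identity-diag (r ↑ʳ b)))) ⟩
      det N * 1ℤ                                    ≡⟨ ℤP.*-identityʳ (det N) ⟩
      det N                                         ∎

  det-inverse-≡±1 : Unimodular U → det V ≡± 1ℤ
  det-inverse-≡±1 unimodular =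
    unit-factor (det V) unimodular (trans (sym (det-· U V)) (trans (det-cong U·V≋I) (det-identity {r ℕ.+ m})))

  det-stack-·-inverse : ∀ (B : Mat m (r ℕ.+ m)) → det (stack A (B · V)) ≡ det (stack (A · U) B) * det V
  det-stack-·-inverse B = begin
    det (stack A (B · V))              ≡⟨ det-cong (stack-congˡ (B · V) (λ i j → sym (A·U·V≋A i j))) ⟩
    det (stack ((A · U) · V) (B · V))  ≡⟨ det-cong (stack-· (A · U) B V) ⟨
    det (stack (A · U) B · V)          ≡⟨ det-· (stack (A · U) B) V ⟩
    det (stack (A · U) B) * det V      ∎

  det-≡±gcd : ∀ {g} → IsGreatestDivisor A g → LowerTriangular N → det N ≡± + g
  det-≡±gcd {g} (g∣minors , greatest) lowerN = ∣x∣≡n⇒x≡±n (det N) (ℕD.∣-antisym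
    (greatest (det N) (λ c increasing → ℤD.∣⇒∣ᵤ (det-∣-minors c increasing)))
    (ℤD.∣⇒∣ᵤ (∣-det (+ g) (λ c increasing → ℤD.∣ᵤ⇒∣ (g∣minors c increasing)) lowerN)))


theorem5p2p2 : (r m : ℕ) (A : Mat r (r ℕ.+ m)) (d : ℕ) → 0 ℕ.< d →
    FullRank A → (g : ℕ) → IsGreatestDivisor A g → g ℕD.∣ d →
    (k : ℕ) → d ≡ k ℕ.* g →
    (U : Mat (r ℕ.+ m) (r ℕ.+ m)) → Unimodular U →
    IsRHNF (leftBlock r m (A · U)) → (∀ i j → rightBlock r m (A · U) i j ≡ 0ℤ) →
    (U′ : Mat r r) → Unimodular U′ →
    IsLHNF (leftBlock r m ((U′ · A) · U)) → (∀ i j → rightBlock r m ((U′ · A) · U) i j ≡ 0ℤ) →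
    (B : Mat m (r ℕ.+ m)) →
    IsLHNF (stack ((U′ · A) · U) B) →
    prodF (λ (j : Fin m) → stack ((U′ · A) · U) B (r ↑ʳ j) (r ↑ʳ j)) ≡ + k →
    (∃ λ (V : Mat (r ℕ.+ m) (r ℕ.+ m)) → (∀ i j → (U · V) i j ≡ identity i j) × (∀ i j → (V · U) i j ≡ identity i j))
    × (∀ (V : Mat (r ℕ.+ m) (r ℕ.+ m)) → (∀ i j → (U · V) i j ≡ identity i j) → (∀ i j → (V · U) i j ≡ identity i j) →
    det (stack A (B · V)) ≡ + d ⊎ det (stack A (B · V)) ≡ - (+ d))
theorem5p2p2 r m A d _ _ g gcd _ k d≡k*g U unimodular (lowerN , _) right-zero U′ _ _ _ B (lower , _) diagonal≡k =
  unimodular-inverse U unimodular , λ V U·V≋I V·U≋I →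
    let open LeadingBlock A U V U·V≋I V·U≋I right-zero in
    ≡±-resp (sym (trans (det-stack-·-inverse B) (cong (_* det V) det-stack))) g*k*1≡d
            (≡±-* (≡±-* (det-≡±gcd gcd lowerN) (inj₁ refl)) (det-inverse-≡±1 unimodular))
  where
  P : Mat r (r ℕ.+ m)
  P = (U′ · A) · U
  lower-B : ∀ b j → (r ↑ʳ b) Fin.< j → B b j ≡ 0ℤ
  lower-B b j b<j = trans (sym (stack-↑ʳ P B b j)) (lower (r ↑ʳ b) j b<j)
  det-stack : det (stack (A · U) B) ≡ det (leftBlock r m (A · U)) * + k
  det-stack = trans
    (det-stack-lowerTriangular (A · U) B (stack-lowerTriangular (A · U) B lowerN right-zero lower-B))
    (cong₂ _*_ (sym (det-lowerTriangular _ lowerN))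
               (trans (prodF-cong (λ b → sym (stack-↑ʳ P B b (r ↑ʳ b)))) diagonal≡k))
  g*k*1≡d : + g * + k * 1ℤ ≡ + d
  g*k*1≡d = trans (ℤP.*-identityʳ _)
                  (trans (ℤP.*-comm (+ g) (+ k)) (trans (sym (ℤP.pos-* k g)) (cong +_ (sym d≡k*g))))
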